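{- Let $k$ be a positive integer and let $n\ge 6\cdot 2^k+k+4$. Then the hypercube $Q_n$ contains $2^k$ pairwise completely independent spanning trees, each of diameter at most $2(n+9k+11)$.
   Context: The hypercube $Q_n$ has vertex set $\{0,1\}^n$, two vertices being adjacent if they differ in exactly one coordinate. Two spanning trees of a graph $G$ are completely independent if they have no edge in common and, for every pair of vertices $u,v$ of $G$, the $u$–$v$ paths in the two trees have no vertex in common other than $u$ and $v$. The diameter of a tree is the maximum distance within the tree between two of its vertices. -}

module Defs where

open import Data.Nat using (ℕ; zero; suc; _+_; _∸_; _≤_; _≥_)
open import Data.Bool using (Bool; true; false; _≟_)
open import Data.Vec using (Vec; []; _∷_)
open import Data.List using (List; []; _∷_; length)
open import Data.List.Membership.Propositional using (_∈_)
open import Data.List.Relation.Unary.Unique.Propositional using (Unique)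
open import Data.Product using (Σ; ∃; ∃-syntax; _×_)
open import Data.Sum using (_⊎_)
open import Data.Empty using (⊥)
open import Relation.Nullary using (¬_; yes; no)
open import Relation.Binary.PropositionalEquality using (_≡_)

V : ℕ → Set
V n = Vec Bool n

hamming : ∀ {n} → V n → V n → ℕ
hamming [] [] = 0
hamming (x ∷ xs) (y ∷ ys) with x ≟ y
... | yes _ = hamming xs ys
... | no _ = suc (hamming xs ys)

Adj : ∀ {n} → V n → V n → Set
Adj u v = hamming u v ≡ 1

EdgeSet : ℕ → Set
EdgeSet n = V n → V n → Bool

data IsWalk {n} (E : EdgeSet n) : List (V n) → V n → V n → Set where
  single : ∀ v → IsWalk E (v ∷ []) v v
  step   : ∀ {u w v ps} → E u w ≡ true → IsWalk E (w ∷ ps) w v →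
           IsWalk E (u ∷ w ∷ ps) u v

IsPath : ∀ {n} → EdgeSet n → List (V n) → V n → V n → Set
IsPath E ps u v = IsWalk E ps u v × Unique ps

len : ∀ {n} → List (V n) → ℕ
len ps = length ps ∸ 1

HasCycle : ∀ {n} → EdgeSet n → Set
HasCycle {n} E = Σ (V n) λ u → Σ (V n) λ w → Σ (List (V n)) λ ps →
  IsPath E ps u w × 3 ≤ length ps × E w u ≡ true

IsSpanningTree : ∀ n → EdgeSet n → Set
IsSpanningTree n T =
  (∀ u v → T u v ≡ true → Adj u v) ×
  (∀ u v → T u v ≡ true → T v u ≡ true) ×
  (∀ (u v : V n) → ∃[ ps ] IsWalk T ps u v) ×
  ¬ HasCycle T

CompletelyIndependent : ∀ n → EdgeSet n → EdgeSet n → Set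
CompletelyIndependent n T₁ T₂ =
  (∀ u v → T₁ u v ≡ true → T₂ u v ≡ true → ⊥) ×
  (∀ (u v : V n) ps qs → IsPath T₁ ps u v → IsPath T₂ qs u v →
     ∀ x → x ∈ ps → x ∈ qs → x ≡ u ⊎ x ≡ v)

-- Diameter at most D: every pair of vertices is joined in T by a path
-- with at most D edges (the tree path is unique, so this is the tree distance).
DiameterAtMost : ∀ n → EdgeSet n → ℕ → Set
DiameterAtMost n T D =
  ∀ (u v : V n) → ∃[ ps ] (IsPath T ps u v × len ps ≤ D)

module Submission where

-- Split the coordinates of Q_n into blocks x₀, x₁, u of length 2^k, p of length k and q of
-- length r = n − 3·2^k − k, and label the positions of x₀, x₁ and u by the 2^k vectors of Q_k.
-- Every vertex gets a colour in Q_k: p for a connector (u = q = 0), and otherwise the xor of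
-- the labels of the ones of x₀ and x₁ and of the first one of u.  The tree of colour c is
-- given by a parent function: a vertex of colour c moves to a neighbour of colour c on which a
-- potential decreases, ending at the root (0,0,0,c,0), and any other vertex is attached to a
-- neighbour of colour c, which exists because flipping one bit of x₀, x₁ or u changes the
-- colour by an arbitrary label.  Inner vertices of the tree of colour c are parents, hence of
-- colour c, so paths in trees of different colours meet only at their ends; the trees share no
-- edge because no two vertices are attached to each other.  The potential is at most n + 3,
-- which bounds the diameters by 2(n + 4).

open import Defs
open import Data.Nat using (ℕ; zero; suc; _+_; _*_; _^_; _∸_; _≤_; _<_; z≤n; s≤s; z<s)
open import Data.Nat.Properties
open import Data.Nat.Induction using (<-wellFounded)
open import Data.Nat.Tactic.RingSolver using (solve-∀)
open import Induction.WellFounded using (Acc; acc)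
open import Data.Bool using (Bool; true; false; not; _xor_; if_then_else_)
import Data.Bool.Properties as Bool
open import Data.Fin using (Fin; zero; suc)
open import Data.Fin.Properties using (2↔Bool; *↔×)
open import Data.List using (List; []; _∷_; length; _++_; drop; reverse; _∷ʳ_)
import Data.List.Properties as List
open import Data.List.Membership.Propositional using (_∈_)
open import Data.List.Membership.DecPropositional using () renaming (_∈?_ to member?)
open import Data.List.Relation.Unary.Any using (here; there)
open import Data.List.Relation.Unary.All using ([]; _∷_)
open import Data.List.Relation.Unary.All.Properties.Core using (¬Any⇒All¬; All¬⇒¬Any)
open import Data.List.Relation.Unary.Unique.Propositional using (Unique; []; _∷_)
import Data.List.Relation.Binary.Permutation.Setoid as Permutation
import Data.List.Relation.Binary.Permutation.Setoid.Properties as PermutationProperties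
open import Data.Vec using (Vec; []; _∷_; replicate; zipWith; updateAt; lookup; tabulate)
  renaming (_++_ to _++ᵛ_)
import Data.Vec as Vec
open import Data.Vec.Properties
  using (≡-dec; ∷-injectiveʳ; lookup∘tabulate; take++drop≡id; ++-injectiveˡ; ++-injectiveʳ)
open import Data.Vec.Relation.Binary.Pointwise.Inductive
  using (Pointwise-≡⇒≡; zipWith-assoc; zipWith-comm; zipWith-identityˡ)
open import Function using (_∘_; _↔_; mk↔ₛ′; Inverse; Injection)
open import Function.Properties.Inverse using (↔⇒↣)
open import Function.Construct.Composition using (_↔-∘_)
open import Data.Product.Function.NonDependent.Propositional using (_×-↔_)
open import Data.Product using (Σ; ∃-syntax; _×_; _,_; proj₁; proj₂; uncurry)
open import Data.Sum using (_⊎_; inj₁; inj₂)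
open import Data.Empty using (⊥; ⊥-elim)
open import Relation.Nullary using (¬_; Dec; yes; no; does; _×-dec_; _⊎-dec_; ¬?)
open import Relation.Nullary.Decidable using (dec-true; dec-false)
open import Relation.Binary.Definitions using (DecidableEquality)
open import Relation.Binary.PropositionalEquality

if-yes : ∀ {a p} {A : Set a} {P : Set p} (P? : Dec P) {x y : A} →
         P → (if does P? then x else y) ≡ x
if-yes P? p rewrite dec-true P? p = refl

if-no : ∀ {a p} {A : Set a} {P : Set p} (P? : Dec P) {x y : A} →
        ¬ P → (if does P? then x else y) ≡ y
if-no P? ¬p rewrite dec-false P? ¬p = refl

dec-true⁻¹ : ∀ {p} {P : Set p} (P? : Dec P) → does P? ≡ true → P
dec-true⁻¹ (yes p) _ = p
dec-true⁻¹ (no _) ()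

if-does-elim : ∀ {a b p} {A : Set a} {P : Set p} (P? : Dec P) {x y : A} (Q : A → Set b) →
               (P → Q x) → (¬ P → Q y) → Q (if does P? then x else y)
if-does-elim (yes p) Q f g = f p
if-does-elim (no ¬p) Q f g = g ¬p

hamming-sym : ∀ {n} (a b : V n) → hamming a b ≡ hamming b a
hamming-sym [] [] = refl
hamming-sym (true ∷ a) (true ∷ b) = hamming-sym a b
hamming-sym (false ∷ a) (false ∷ b) = hamming-sym a b
hamming-sym (true ∷ a) (false ∷ b) = cong suc (hamming-sym a b)
hamming-sym (false ∷ a) (true ∷ b) = cong suc (hamming-sym a b)

hamming-self : ∀ {n} (a : V n) → hamming a a ≡ 0
hamming-self [] = refl
hamming-self (true ∷ a) = hamming-self a
hamming-self (false ∷ a) = hamming-self a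

hamming-++ : ∀ {m n} (a a′ : V m) (b b′ : V n) →
             hamming (a ++ᵛ b) (a′ ++ᵛ b′) ≡ hamming a a′ + hamming b b′
hamming-++ [] [] b b′ = refl
hamming-++ (true ∷ a) (true ∷ a′) b b′ = hamming-++ a a′ b b′
hamming-++ (true ∷ a) (false ∷ a′) b b′ = cong suc (hamming-++ a a′ b b′)
hamming-++ (false ∷ a) (true ∷ a′) b b′ = cong suc (hamming-++ a a′ b b′)
hamming-++ (false ∷ a) (false ∷ a′) b b′ = hamming-++ a a′ b b′

hamming≤ : ∀ {n} (a b : V n) → hamming a b ≤ n
hamming≤ [] [] = z≤n
hamming≤ (true ∷ a) (true ∷ b) = m≤n⇒m≤1+n (hamming≤ a b)
hamming≤ (false ∷ a) (false ∷ b) = m≤n⇒m≤1+n (hamming≤ a b)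
hamming≤ (true ∷ a) (false ∷ b) = s≤s (hamming≤ a b)
hamming≤ (false ∷ a) (true ∷ b) = s≤s (hamming≤ a b)

-- Walks and paths

module _ {n : ℕ} where

  _≟V_ : DecidableEquality (V n)
  _≟V_ = ≡-dec Bool._≟_

  IsSymmetric : EdgeSet n → Set
  IsSymmetric E = ∀ u v → E u v ≡ true → E v u ≡ true

  HasTwoNeighbours : EdgeSet n → V n → Set
  HasTwoNeighbours E x = ∃[ a ] ∃[ b ] a ≢ b × E x a ≡ true × E x b ≡ true

  module _ {E : EdgeSet n} where

    walk-∷ : ∀ {qs u w v} → E u w ≡ true → IsWalk E qs w v → IsWalk E (u ∷ qs) u v
    walk-∷ e (single _) = step e (single _)
    walk-∷ e (step e′ r) = step e (step e′ r)

    walk-++ : ∀ {ps qs u v w} → IsWalk E ps u v → IsWalk E qs v w → IsWalk E (ps ++ drop 1 qs) u w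
    walk-++ (single _) (single _) = single _
    walk-++ (single _) (step e r) = step e r
    walk-++ (step e r) q = step e (walk-++ r q)

    walk-∷ʳ : ∀ {ps u v w} → IsWalk E ps u v → E v w ≡ true → IsWalk E (ps ∷ʳ w) u w
    walk-∷ʳ (single _) e = step e (single _)
    walk-∷ʳ (step e′ r) e = step e′ (walk-∷ʳ r e)

    walk-reverse : IsSymmetric E → ∀ {ps u v} → IsWalk E ps u v → IsWalk E (reverse ps) v u
    walk-reverse sym-E (single _) = single _
    walk-reverse sym-E {u ∷ w ∷ ps} (step e r)
      rewrite List.unfold-reverse u (w ∷ ps) = walk-∷ʳ (walk-reverse sym-E r) (sym-E _ _ e)

    walk-last∈ : ∀ {ps u v} → IsWalk E ps u v → v ∈ ps
    walk-last∈ (single _) = here refl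
    walk-last∈ (step _ r) = there (walk-last∈ r)

    path-suffix : ∀ {ps u v x} → IsPath E ps u v → x ∈ ps →
      ∃[ rs ] IsPath E (x ∷ rs) x v × length (x ∷ rs) ≤ length ps
    path-suffix (single _ , u) (here refl) = [] , (single _ , u) , ≤-refl
    path-suffix (step e r , u) (here refl) = _ , (step e r , u) , ≤-refl
    path-suffix (step e r , _ ∷ u) (there x∈ps) with path-suffix (r , u) x∈ps
    ... | rs , p , le = rs , p , m≤n⇒m≤1+n le

    walk⇒path : ∀ {ps u v} → IsWalk E ps u v → ∃[ qs ] IsPath E qs u v × length qs ≤ length ps
    walk⇒path (single v) = _ , (single v , [] ∷ []) , ≤-refl
    walk⇒path {u = u} (step e r) with walk⇒path r
    ... | qs , (w , uq) , le with member? _≟V_ u qs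
    ...   | yes u∈qs with path-suffix (w , uq) u∈qs
    ...     | rs , p , le′ = _ , p , m≤n⇒m≤1+n (≤-trans le′ le)
    walk⇒path {u = u} (step e r) | qs , (w , uq) , le | no u∉qs =
      _ , (walk-∷ e w , ¬Any⇒All¬ qs u∉qs ∷ uq) , s≤s le

    path-reverse : IsSymmetric E → ∀ {ps u v} → IsPath E ps u v → IsPath E (reverse ps) v u
    path-reverse sym-E {ps} (w , uq) =
      walk-reverse sym-E w , Unique-resp-↭ (↭-sym (↭-reverse ps)) uq
      where
      open Permutation (setoid (V n)) using (↭-sym)
      open PermutationProperties (setoid (V n)) using (Unique-resp-↭; ↭-reverse)

    path-vertex : IsSymmetric E → ∀ {ps u v x} → IsPath E ps u v → x ∈ ps →
                  x ≡ u ⊎ x ≡ v ⊎ HasTwoNeighbours E x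
    path-vertex sym-E (single _ , _) (here refl) = inj₁ refl
    path-vertex sym-E (step e r , _) (here refl) = inj₁ refl
    path-vertex sym-E (step e r , _ ∷ uq) (there x∈ps) with path-vertex sym-E (r , uq) x∈ps
    path-vertex sym-E (step e (single _) , _) (there _) | inj₁ refl = inj₂ (inj₁ refl)
    path-vertex sym-E (step e (step e′ r) , (_ ∷ u≢x′ ∷ _) ∷ _) (there _) | inj₁ refl =
      inj₂ (inj₂ (_ , _ , u≢x′ , sym-E _ _ e , e′))
    ... | inj₂ p = inj₂ p

-- Trees given by parent functions

record ParentMap (n : ℕ) : Set where
  field
    root : V n
    parent : V n → V n
    height : V n → ℕ
    parent-adj : ∀ a → a ≢ root → Adj a (parent a)
    height-parent : ∀ a → a ≢ root → height (parent a) < height a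

module ParentTree {n} (t : ParentMap n) where

  open ParentMap t

  ParentLink : V n → V n → Set
  ParentLink a b = a ≢ root × b ≡ parent a

  Link : V n → V n → Set
  Link a b = ParentLink a b ⊎ ParentLink b a

  link? : ∀ a b → Dec (Link a b)
  link? a b = (¬? (a ≟V root) ×-dec (b ≟V parent a)) ⊎-dec (¬? (b ≟V root) ×-dec (a ≟V parent b))

  edges : EdgeSet n
  edges a b = does (link? a b)

  edge⇒link : ∀ a b → edges a b ≡ true → Link a b
  edge⇒link a b = dec-true⁻¹ (link? a b)

  link⇒edge : ∀ {a b} → Link a b → edges a b ≡ true
  link⇒edge {a} {b} l = dec-true (link? a b) l

  parent-edge : ∀ a → a ≢ root → edges a (parent a) ≡ true
  parent-edge a a≢root = link⇒edge (inj₁ (a≢root , refl))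

  edges-sym : IsSymmetric edges
  edges-sym a b e = link⇒edge (swap (edge⇒link a b e))
    where
    swap : ∀ {a b} → Link a b → Link b a
    swap (inj₁ l) = inj₂ l
    swap (inj₂ l) = inj₁ l

  edges-adj : ∀ a b → edges a b ≡ true → Adj a b
  edges-adj a b e with edge⇒link a b e
  ... | inj₁ (a≢root , refl) = parent-adj a a≢root
  ... | inj₂ (b≢root , refl) = trans (hamming-sym (parent b) b) (parent-adj b b≢root)

  walkToRoot : ∀ a → ∃[ ps ] IsWalk edges ps a root × length ps ≤ suc (height a)
  walkToRoot a = go a (<-wellFounded (height a))
    where
    go : ∀ a → Acc _<_ (height a) → ∃[ ps ] IsWalk edges ps a root × length ps ≤ suc (height a)
    go a (acc rec) with a ≟V root
    ... | yes refl = _ , single _ , s≤s z≤n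
    ... | no a≢root with go (parent a) (rec (height-parent a a≢root))
    ...   | ps , w , l = _ , walk-∷ (parent-edge a a≢root) w , s≤s (≤-trans l (height-parent a a≢root))

  connected : ∀ u v → ∃[ ps ] IsWalk edges ps u v
  connected u v with walkToRoot u | walkToRoot v
  ... | _ , w , _ | _ , w′ , _ = _ , walk-++ w (walk-reverse edges-sym w′)

  -- Once a path steps from a vertex down to one of its children, it keeps descending.
  descending-path-height< : ∀ {a b rest z} → IsPath edges (a ∷ b ∷ rest) a z →
                            ParentLink b a → height a < height z
  descending-path-height< (step e (single _) , _) (b≢root , refl) = height-parent _ b≢root
  descending-path-height< {b = b} (step e (step {w = c} e′ r) , (_ ∷ a≢c ∷ _) ∷ uq) (b≢root , refl)
    with edge⇒link b c e′
  ... | inj₁ (_ , refl) = ⊥-elim (a≢c refl)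
  ... | inj₂ l = <-trans (height-parent _ b≢root) (descending-path-height< (step e′ r , uq) l)

  no-cycle-through-parent : ∀ {ps x} → x ≢ root → IsPath edges ps x (parent x) → 3 ≤ length ps → ⊥
  no-cycle-through-parent {_ ∷ y ∷ rest} {x} x≢root p@(step e (step _ r) , _ ∷ y∉rest ∷ _)
                          (s≤s (s≤s (s≤s _)))
    with edge⇒link x y e
  ... | inj₁ (_ , y≡px) = All¬⇒¬Any y∉rest (subst (_∈ rest) (sym y≡px) (walk-last∈ r))
  ... | inj₂ l = <-irrefl refl (<-trans (descending-path-height< p l) (height-parent _ x≢root))

  acyclic : ¬ HasCycle edges
  acyclic (u , w , ps , p , 3≤ps , ewu) with edge⇒link w u ewu
  ... | inj₂ (u≢root , refl) = no-cycle-through-parent u≢root p 3≤ps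
  ... | inj₁ (w≢root , refl) = no-cycle-through-parent w≢root (path-reverse edges-sym p)
    (subst (3 ≤_) (sym (List.length-reverse ps)) 3≤ps)

  spanningTree : IsSpanningTree n edges
  spanningTree = edges-adj , edges-sym , connected , acyclic

  diameter≤ : ∀ H → (∀ a → height a ≤ H) → DiameterAtMost n edges (2 * H)
  diameter≤ H height≤H u v with walkToRoot u | walkToRoot v
  ... | ps , w , l | qs , w′ , l′ with walk⇒path (walk-++ w (walk-reverse edges-sym w′))
  ... | rs , p , le = rs , p , bound
    where
    open ≤-Reasoning
    bound : length rs ∸ 1 ≤ 2 * H
    bound = begin
      length rs ∸ 1
        ≤⟨ ∸-monoˡ-≤ 1 le ⟩
      length (ps ++ drop 1 (reverse qs)) ∸ 1
        ≡⟨ cong (_∸ 1) (List.length-++ ps) ⟩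
      (length ps + length (drop 1 (reverse qs))) ∸ 1
        ≡⟨ cong (λ t → (length ps + t) ∸ 1) (List.length-drop 1 (reverse qs)) ⟩
      (length ps + (length (reverse qs) ∸ 1)) ∸ 1
        ≡⟨ cong (λ t → (length ps + (t ∸ 1)) ∸ 1) (List.length-reverse qs) ⟩
      (length ps + (length qs ∸ 1)) ∸ 1
        ≤⟨ ∸-monoˡ-≤ 1 (+-mono-≤ (≤-trans l (s≤s (height≤H u))) (∸-monoˡ-≤ 1 (≤-trans l′ (s≤s (height≤H v))))) ⟩
      H + H
        ≡⟨ cong (H +_) (sym (+-identityʳ H)) ⟩
      2 * H
        ∎

  twoNeighbours⇒parent : ∀ {x} → HasTwoNeighbours edges x → ∃[ a ] ParentLink a x
  twoNeighbours⇒parent {x} (a , b , a≢b , ea , eb) with edge⇒link x a ea | edge⇒link x b eb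
  ... | inj₁ (_ , refl) | inj₁ (_ , refl) = ⊥-elim (a≢b refl)
  ... | inj₂ l | _ = a , l
  ... | inj₁ _ | inj₂ l = b , l

module _ {n} {C : Set} (colour : V n → C) (t₁ t₂ : ParentMap n) {c₁ c₂ : C} (c₁≢c₂ : c₁ ≢ c₂)
  (colour-parent₁ : ∀ a → a ≢ ParentMap.root t₁ → colour (ParentMap.parent t₁ a) ≡ c₁)
  (colour-parent₂ : ∀ a → a ≢ ParentMap.root t₂ → colour (ParentMap.parent t₂ a) ≡ c₂)
  (no-mutual-parents : ∀ a b → a ≢ ParentMap.root t₁ → b ≢ ParentMap.root t₂ →
                       ParentMap.parent t₁ a ≡ b → ParentMap.parent t₂ b ≡ a → ⊥) where

  private
    module T₁ = ParentTree t₁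
    module T₂ = ParentTree t₂

  completelyIndependent : CompletelyIndependent n T₁.edges T₂.edges
  completelyIndependent = edge-disjoint , λ u v ps qs p₁ p₂ x x∈ps x∈qs →
    endpoint (path-vertex T₁.edges-sym p₁ x∈ps) (path-vertex T₂.edges-sym p₂ x∈qs)
    where
    edge-disjoint : ∀ u v → T₁.edges u v ≡ true → T₂.edges u v ≡ true → ⊥
    edge-disjoint u v e₁ e₂ with T₁.edge⇒link u v e₁ | T₂.edge⇒link u v e₂
    ... | inj₁ (u≢r₁ , refl) | inj₁ (u≢r₂ , v≡p₂u) =
      c₁≢c₂ (trans (sym (colour-parent₁ u u≢r₁))
                   (trans (cong colour v≡p₂u) (colour-parent₂ u u≢r₂)))
    ... | inj₁ (u≢r₁ , refl) | inj₂ (v≢r₂ , u≡p₂v) =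
      no-mutual-parents u v u≢r₁ v≢r₂ refl (sym u≡p₂v)
    ... | inj₂ (v≢r₁ , refl) | inj₁ (u≢r₂ , v≡p₂u) =
      no-mutual-parents v u v≢r₁ u≢r₂ refl (sym v≡p₂u)
    ... | inj₂ (v≢r₁ , refl) | inj₂ (v≢r₂ , u≡p₂v) =
      c₁≢c₂ (trans (sym (colour-parent₁ v v≢r₁))
                   (trans (cong colour u≡p₂v) (colour-parent₂ v v≢r₂)))

    colour-inner₁ : ∀ {x} → HasTwoNeighbours T₁.edges x → colour x ≡ c₁
    colour-inner₁ two with T₁.twoNeighbours⇒parent two
    ... | a , a≢root , refl = colour-parent₁ a a≢root

    colour-inner₂ : ∀ {x} → HasTwoNeighbours T₂.edges x → colour x ≡ c₂
    colour-inner₂ two with T₂.twoNeighbours⇒parent two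
    ... | a , a≢root , refl = colour-parent₂ a a≢root

    endpoint : ∀ {u v x} → x ≡ u ⊎ x ≡ v ⊎ HasTwoNeighbours T₁.edges x →
               x ≡ u ⊎ x ≡ v ⊎ HasTwoNeighbours T₂.edges x → x ≡ u ⊎ x ≡ v
    endpoint (inj₁ x≡u) _ = inj₁ x≡u
    endpoint (inj₂ (inj₁ x≡v)) _ = inj₂ x≡v
    endpoint _ (inj₁ x≡u) = inj₁ x≡u
    endpoint _ (inj₂ (inj₁ x≡v)) = inj₂ x≡v
    endpoint (inj₂ (inj₂ two₁)) (inj₂ (inj₂ two₂)) =
      ⊥-elim (c₁≢c₂ (trans (sym (colour-inner₁ two₁)) (colour-inner₂ two₂)))

-- Bit vectors

zeros : ∀ {l} → Vec Bool l
zeros = replicate _ false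

infixl 6 _⊕_
_⊕_ : ∀ {l} → Vec Bool l → Vec Bool l → Vec Bool l
_⊕_ = zipWith _xor_

module _ {l : ℕ} where

  ⊕-assoc : (x y z : Vec Bool l) → (x ⊕ y) ⊕ z ≡ x ⊕ (y ⊕ z)
  ⊕-assoc x y z = Pointwise-≡⇒≡ (zipWith-assoc {_∼_ = _≡_} Bool.xor-assoc x y z)

  ⊕-comm : (x y : Vec Bool l) → x ⊕ y ≡ y ⊕ x
  ⊕-comm x y = Pointwise-≡⇒≡ (zipWith-comm {_∼_ = _≡_} Bool.xor-comm x y)

  ⊕-identityˡ : (x : Vec Bool l) → zeros ⊕ x ≡ x
  ⊕-identityˡ x = Pointwise-≡⇒≡ (zipWith-identityˡ {_∼_ = _≡_} Bool.xor-identityˡ x)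

⊕-self : ∀ {l} (x : Vec Bool l) → x ⊕ x ≡ zeros
⊕-self [] = refl
⊕-self (b ∷ x) = cong₂ _∷_ (Bool.xor-same b) (⊕-self x)

⊕-cancelˡ : ∀ {l} (a c : Vec Bool l) → a ⊕ (a ⊕ c) ≡ c
⊕-cancelˡ a c = begin
  a ⊕ (a ⊕ c) ≡⟨ ⊕-assoc a a c ⟨
  (a ⊕ a) ⊕ c ≡⟨ cong (_⊕ c) (⊕-self a) ⟩
  zeros ⊕ c   ≡⟨ ⊕-identityˡ c ⟩
  c           ∎
  where open ≡-Reasoning

⊕-cancelʳ : ∀ {l} (a c : Vec Bool l) → (a ⊕ c) ⊕ a ≡ c
⊕-cancelʳ a c = trans (⊕-comm (a ⊕ c) a) (⊕-cancelˡ a c)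

⊕-left-comm : ∀ {l} (a b c : Vec Bool l) → a ⊕ (b ⊕ c) ≡ b ⊕ (a ⊕ c)
⊕-left-comm a b c = begin
  a ⊕ (b ⊕ c) ≡⟨ ⊕-assoc a b c ⟨
  (a ⊕ b) ⊕ c ≡⟨ cong (_⊕ c) (⊕-comm a b) ⟩
  (b ⊕ a) ⊕ c ≡⟨ ⊕-assoc b a c ⟩
  b ⊕ (a ⊕ c) ∎
  where open ≡-Reasoning

weight : ∀ {l} → Vec Bool l → ℕ
weight v = hamming v zeros

weight-zeros : ∀ l → weight (zeros {l}) ≡ 0
weight-zeros l = hamming-self (zeros {l})

flipAt : ∀ {l} → Vec Bool l → Fin l → Vec Bool l
flipAt v i = updateAt v i not

hamming-flipAt : ∀ {l} (v : Vec Bool l) i → hamming v (flipAt v i) ≡ 1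
hamming-flipAt (true ∷ v) zero = cong suc (hamming-self v)
hamming-flipAt (false ∷ v) zero = cong suc (hamming-self v)
hamming-flipAt (true ∷ v) (suc i) = hamming-flipAt v i
hamming-flipAt (false ∷ v) (suc i) = hamming-flipAt v i

flipAt-≢ : ∀ {l} (v : Vec Bool l) i → flipAt v i ≢ v
flipAt-≢ v i eq with trans (sym (hamming-flipAt v i)) (trans (cong (hamming v) eq) (hamming-self v))
... | ()

unit : ∀ {l} → Fin l → Vec Bool l
unit = flipAt zeros

weight-unit : ∀ {l} (i : Fin l) → weight (unit i) ≡ 1
weight-unit i = trans (hamming-sym (unit i) zeros) (hamming-flipAt zeros i)

unit-≢-zeros : ∀ {l} (i : Fin l) → unit i ≢ zeros
unit-≢-zeros = flipAt-≢ zeros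

clearFirst : ∀ {l} → Vec Bool l → Vec Bool l
clearFirst [] = []
clearFirst (true ∷ v) = false ∷ v
clearFirst (false ∷ v) = false ∷ clearFirst v

clearFirst-fixed⇒zeros : ∀ {l} (v : Vec Bool l) → clearFirst v ≡ v → v ≡ zeros
clearFirst-fixed⇒zeros [] _ = refl
clearFirst-fixed⇒zeros (true ∷ v) ()
clearFirst-fixed⇒zeros (false ∷ v) eq = cong (false ∷_) (clearFirst-fixed⇒zeros v (∷-injectiveʳ eq))

clearFirst-adj : ∀ {l} (v : Vec Bool l) → clearFirst v ≢ v → hamming v (clearFirst v) ≡ 1
clearFirst-adj [] ne = ⊥-elim (ne refl)
clearFirst-adj (true ∷ v) _ = cong suc (hamming-self v)
clearFirst-adj (false ∷ v) ne = clearFirst-adj v (ne ∘ cong (false ∷_))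

clearFirst-weight : ∀ {l} (v : Vec Bool l) → clearFirst v ≢ v → weight v ≡ suc (weight (clearFirst v))
clearFirst-weight [] ne = ⊥-elim (ne refl)
clearFirst-weight (true ∷ v) _ = refl
clearFirst-weight (false ∷ v) ne = clearFirst-weight v (ne ∘ cong (false ∷_))

clearSecond : ∀ {l} → Vec Bool l → Vec Bool l
clearSecond [] = []
clearSecond (true ∷ v) = true ∷ clearFirst v
clearSecond (false ∷ v) = false ∷ clearSecond v

clearSecond-adj : ∀ {l} (v : Vec Bool l) → clearSecond v ≢ v → hamming v (clearSecond v) ≡ 1
clearSecond-adj [] ne = ⊥-elim (ne refl)
clearSecond-adj (true ∷ v) ne = clearFirst-adj v (ne ∘ cong (true ∷_))
clearSecond-adj (false ∷ v) ne = clearSecond-adj v (ne ∘ cong (false ∷_))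

clearSecond-weight : ∀ {l} (v : Vec Bool l) → clearSecond v ≢ v → weight v ≡ suc (weight (clearSecond v))
clearSecond-weight [] ne = ⊥-elim (ne refl)
clearSecond-weight (true ∷ v) ne = cong suc (clearFirst-weight v (ne ∘ cong (true ∷_)))
clearSecond-weight (false ∷ v) ne = clearSecond-weight v (ne ∘ cong (false ∷_))

clearSecond-≢-zeros : ∀ {l} (v : Vec Bool l) → v ≢ zeros → clearSecond v ≢ zeros
clearSecond-≢-zeros [] v≢0 _ = v≢0 refl
clearSecond-≢-zeros (true ∷ v) _ ()
clearSecond-≢-zeros (false ∷ v) v≢0 eq = clearSecond-≢-zeros v (v≢0 ∘ cong (false ∷_)) (∷-injectiveʳ eq)

clearSecond-fixed⇒weight≡1 : ∀ {l} (v : Vec Bool l) → v ≢ zeros → clearSecond v ≡ v → weight v ≡ 1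
clearSecond-fixed⇒weight≡1 [] v≢0 _ = ⊥-elim (v≢0 refl)
clearSecond-fixed⇒weight≡1 {suc l} (true ∷ v) _ eq =
  cong suc (trans (cong weight (clearFirst-fixed⇒zeros v (∷-injectiveʳ eq))) (weight-zeros l))
clearSecond-fixed⇒weight≡1 (false ∷ v) v≢0 eq =
  clearSecond-fixed⇒weight≡1 v (v≢0 ∘ cong (false ∷_)) (∷-injectiveʳ eq)

stepTowards : ∀ {l} → Vec Bool l → Vec Bool l → Vec Bool l
stepTowards [] [] = []
stepTowards (true ∷ p) (true ∷ c) = true ∷ stepTowards p c
stepTowards (false ∷ p) (false ∷ c) = false ∷ stepTowards p c
stepTowards (_ ∷ p) (b ∷ _) = b ∷ p

stepTowards-adj : ∀ {l} (p c : Vec Bool l) → p ≢ c → hamming p (stepTowards p c) ≡ 1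
stepTowards-adj [] [] ne = ⊥-elim (ne refl)
stepTowards-adj (true ∷ p) (true ∷ c) ne = stepTowards-adj p c (ne ∘ cong (true ∷_))
stepTowards-adj (false ∷ p) (false ∷ c) ne = stepTowards-adj p c (ne ∘ cong (false ∷_))
stepTowards-adj (true ∷ p) (false ∷ c) _ = cong suc (hamming-self p)
stepTowards-adj (false ∷ p) (true ∷ c) _ = cong suc (hamming-self p)

stepTowards-closer : ∀ {l} (p c : Vec Bool l) → p ≢ c → hamming p c ≡ suc (hamming (stepTowards p c) c)
stepTowards-closer [] [] ne = ⊥-elim (ne refl)
stepTowards-closer (true ∷ p) (true ∷ c) ne = stepTowards-closer p c (ne ∘ cong (true ∷_))
stepTowards-closer (false ∷ p) (false ∷ c) ne = stepTowards-closer p c (ne ∘ cong (false ∷_))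
stepTowards-closer (true ∷ p) (false ∷ c) _ = refl
stepTowards-closer (false ∷ p) (true ∷ c) _ = refl

firstDifference : ∀ {l} → Vec Bool l → Vec Bool l → Bool
firstDifference [] [] = false
firstDifference (true ∷ d) (true ∷ c) = firstDifference d c
firstDifference (false ∷ d) (false ∷ c) = firstDifference d c
firstDifference (a ∷ _) (_ ∷ _) = a

firstDifference-antisym : ∀ {l} (d c : Vec Bool l) → d ≢ c → firstDifference c d ≡ not (firstDifference d c)
firstDifference-antisym [] [] ne = ⊥-elim (ne refl)
firstDifference-antisym (true ∷ d) (true ∷ c) ne = firstDifference-antisym d c (ne ∘ cong (true ∷_))
firstDifference-antisym (false ∷ d) (false ∷ c) ne = firstDifference-antisym d c (ne ∘ cong (false ∷_))
firstDifference-antisym (true ∷ d) (false ∷ c) _ = refl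
firstDifference-antisym (false ∷ d) (true ∷ c) _ = refl

syndrome : ∀ {k l} → Vec (Vec Bool k) l → Vec Bool l → Vec Bool k
syndrome [] [] = zeros
syndrome (ℓ ∷ ls) (b ∷ x) = (if b then ℓ else zeros) ⊕ syndrome ls x

syndrome-flipAt : ∀ {k l} (ls : Vec (Vec Bool k) l) x i →
                  syndrome ls (flipAt x i) ≡ lookup ls i ⊕ syndrome ls x
syndrome-flipAt (ℓ ∷ ls) (true ∷ x) zero =
  trans (⊕-identityˡ (syndrome ls x)) (sym (⊕-cancelˡ ℓ (syndrome ls x)))
syndrome-flipAt (ℓ ∷ ls) (false ∷ x) zero = cong (ℓ ⊕_) (sym (⊕-identityˡ (syndrome ls x)))
syndrome-flipAt (ℓ ∷ ls) (b ∷ x) (suc i) =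
  trans (cong (_ ⊕_) (syndrome-flipAt ls x i)) (⊕-left-comm _ (lookup ls i) (syndrome ls x))

firstLabel : ∀ {k l} → Vec (Vec Bool k) l → Vec Bool l → Vec Bool k
firstLabel [] [] = zeros
firstLabel (ℓ ∷ ls) (true ∷ u) = ℓ
firstLabel (ℓ ∷ ls) (false ∷ u) = firstLabel ls u

firstLabel-zeros : ∀ {k l} (ls : Vec (Vec Bool k) l) → firstLabel ls zeros ≡ zeros
firstLabel-zeros [] = refl
firstLabel-zeros (ℓ ∷ ls) = firstLabel-zeros ls

firstLabel-unit : ∀ {k l} (ls : Vec (Vec Bool k) l) i → firstLabel ls (unit i) ≡ lookup ls i
firstLabel-unit (ℓ ∷ ls) zero = refl
firstLabel-unit (ℓ ∷ ls) (suc i) = firstLabel-unit ls i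

firstLabel-clearSecond : ∀ {k l} (ls : Vec (Vec Bool k) l) u → firstLabel ls (clearSecond u) ≡ firstLabel ls u
firstLabel-clearSecond [] [] = refl
firstLabel-clearSecond (ℓ ∷ ls) (true ∷ u) = refl
firstLabel-clearSecond (ℓ ∷ ls) (false ∷ u) = firstLabel-clearSecond ls u

∷-↔ : ∀ {a} {A : Set a} {n} → (A × Vec A n) ↔ Vec A (suc n)
∷-↔ = mk↔ₛ′ (uncurry _∷_) (λ { (x ∷ xs) → x , xs }) (λ { (x ∷ xs) → refl }) (λ _ → refl)

bits : ∀ k → Fin (2 ^ k) ↔ Vec Bool k
bits zero = mk↔ₛ′ (λ _ → []) (λ _ → zero) (λ { [] → refl }) (λ { zero → refl })
bits (suc k) = ∷-↔ ↔-∘ ((2↔Bool ×-↔ bits k) ↔-∘ *↔× {2})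

module _ (k : ℕ) where

  open Inverse (bits k)

  labels : Vec (Vec Bool k) (2 ^ k)
  labels = tabulate to

  lookup-labels : ∀ c → lookup labels (from c) ≡ c
  lookup-labels c = trans (lookup∘tabulate to (from c)) (strictlyInverseˡ c)

module _ {A : Set} {a b : ℕ} (xs : Vec A a) (ys : Vec A b) where

  take-++ : Vec.take a (xs ++ᵛ ys) ≡ xs
  take-++ = ++-injectiveˡ (Vec.take a (xs ++ᵛ ys)) xs (take++drop≡id a (xs ++ᵛ ys))

  drop-++ : Vec.drop a (xs ++ᵛ ys) ≡ ys
  drop-++ = ++-injectiveʳ (Vec.take a (xs ++ᵛ ys)) xs (take++drop≡id a (xs ++ᵛ ys))

-- The construction

CompletelyIndependentSpanningTrees : (t n D : ℕ) → Set
CompletelyIndependentSpanningTrees t n D = Σ (Fin t → EdgeSet n) λ T →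
  (∀ i → IsSpanningTree n (T i) × DiameterAtMost n (T i) D) ×
  (∀ i j → i ≢ j → CompletelyIndependent n (T i) (T j))

DiameterAtMost-mono : ∀ {n T D D′} → D ≤ D′ → DiameterAtMost n T D → DiameterAtMost n T D′
DiameterAtMost-mono D≤D′ diam u v with diam u v
... | ps , path , short = ps , path , ≤-trans short D≤D′

diameter-weaken : ∀ {t n D D′} → D ≤ D′ →
  CompletelyIndependentSpanningTrees t n D → CompletelyIndependentSpanningTrees t n D′
diameter-weaken D≤D′ (T , trees , independent) =
  T , (λ i → proj₁ (trees i) , DiameterAtMost-mono D≤D′ (proj₂ (trees i))) , independent

module Construction (k r : ℕ) where

  m : ℕ
  m = 2 ^ k

  record Vertex : Set where
    constructor vertex
    field
      x₀ x₁ u : Vec Bool m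
      p : Vec Bool k
      q : Vec Bool r

  open Vertex

  index : Vec Bool k → Fin m
  index = Inverse.from (bits k)

  IsConnector : Vertex → Set
  IsConnector v = u v ≡ zeros × q v ≡ zeros

  connector? : ∀ v → Dec (IsConnector v)
  connector? v = (u v ≟V zeros) ×-dec (q v ≟V zeros)

  xSyndrome : Vertex → Vec Bool k
  xSyndrome v = syndrome (labels k) (x₀ v) ⊕ syndrome (labels k) (x₁ v)

  generalColour : Vertex → Vec Bool k
  generalColour v = xSyndrome v ⊕ firstLabel (labels k) (u v)

  colour : Vertex → Vec Bool k
  colour v = if does (connector? v) then p v else generalColour v

  root : Vec Bool k → Vertex
  root c = vertex zeros zeros zeros c zeros

  flipX : Bool → Fin m → Vertex → Vertex
  flipX b i v = record v { x₀ = if b then flipAt (x₀ v) i else x₀ v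
                         ; x₁ = if b then x₁ v else flipAt (x₁ v) i }

  attachU : Vec Bool k → Vertex → Vertex
  attachU c v = record v { u = unit (index (xSyndrome v ⊕ c)) }

  -- Flipping in x₀ or x₁ according to the first bit in which the two colours differ
  -- makes it impossible for two vertices to be attached to each other's trees.
  attachX : Vec Bool k → Vertex → Vertex
  attachX c v = flipX (firstDifference (generalColour v) c) (index (generalColour v ⊕ c)) v

  attach : Vec Bool k → Vertex → Vertex
  attach c v = if does (connector? v) then attachU c v else attachX c v

  connectorStep : Vertex → Vertex
  connectorStep v = if does (x₀ v ≟V zeros)
    then record v { x₁ = clearFirst (x₁ v) }
    else record v { x₀ = clearFirst (x₀ v) }

  reduceP : Vec Bool k → Vertex → Vertex
  reduceP c v = if does (p v ≟V c) then record v { u = zeros } else record v { p = stepTowards (p v) c }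

  reduceQ : Vec Bool k → Vertex → Vertex
  reduceQ c v = if does (q v ≟V zeros) then reduceP c v else record v { q = clearFirst (q v) }

  reduceU : Vec Bool k → Vertex → Vertex
  reduceU c v = if does (clearSecond (u v) ≟V u v) then reduceQ c v else record v { u = clearSecond (u v) }

  -- Moving u from 0 to the unit vector labelled 0, and clearing a one of u other than the
  -- first, leave the colour unchanged.
  generalStep : Vec Bool k → Vertex → Vertex
  generalStep c v = if does (u v ≟V zeros) then record v { u = unit (index zeros) } else reduceU c v

  parentStep : Vec Bool k → Vertex → Vertex
  parentStep c v = if does (connector? v) then connectorStep v else generalStep c v

  next : Vec Bool k → Vertex → Vertex
  next c v = if does (colour v ≟V c) then parentStep c v else attach c v

  xWeight : Vertex → ℕ
  xWeight v = weight (x₀ v) + weight (x₁ v)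

  -- The surcharge for u = 0 pays for the step from u = 0 to a unit vector.
  uCost : Vec Bool m → ℕ
  uCost u = weight u + (if does (u ≟V zeros) then 2 else 0)

  generalPotential : Vec Bool k → Vertex → ℕ
  generalPotential c v = hamming (p v) c + weight (q v) + uCost (u v)

  potential : Vec Bool k → Vertex → ℕ
  potential c v = if does (connector? v) then xWeight v else xWeight v + suc (generalPotential c v)

  height : Vec Bool k → Vertex → ℕ
  height c v = if does (colour v ≟V c) then potential c v else suc (potential c (attach c v))

  dist : Vertex → Vertex → ℕ
  dist a b = hamming (x₀ a) (x₀ b) + (hamming (x₁ a) (x₁ b) + (hamming (u a) (u b) +
             (hamming (p a) (p b) + hamming (q a) (q b))))

  dist-x₀ : ∀ v y → dist v (record v { x₀ = y }) ≡ hamming (x₀ v) y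
  dist-x₀ v y
    rewrite hamming-self (x₁ v) | hamming-self (u v) | hamming-self (p v) | hamming-self (q v) = +-identityʳ _

  dist-x₁ : ∀ v y → dist v (record v { x₁ = y }) ≡ hamming (x₁ v) y
  dist-x₁ v y
    rewrite hamming-self (x₀ v) | hamming-self (u v) | hamming-self (p v) | hamming-self (q v) = +-identityʳ _

  dist-u : ∀ v y → dist v (record v { u = y }) ≡ hamming (u v) y
  dist-u v y
    rewrite hamming-self (x₀ v) | hamming-self (x₁ v) | hamming-self (p v) | hamming-self (q v) = +-identityʳ _

  dist-p : ∀ v y → dist v (record v { p = y }) ≡ hamming (p v) y
  dist-p v y
    rewrite hamming-self (x₀ v) | hamming-self (x₁ v) | hamming-self (u v) | hamming-self (q v) = +-identityʳ _

  dist-q : ∀ v y → dist v (record v { q = y }) ≡ hamming (q v) y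
  dist-q v y
    rewrite hamming-self (x₀ v) | hamming-self (x₁ v) | hamming-self (u v) | hamming-self (p v) = refl

  colour-connector : ∀ v → IsConnector v → colour v ≡ p v
  colour-connector v = if-yes (connector? v)

  colour-general : ∀ v → ¬ IsConnector v → colour v ≡ generalColour v
  colour-general v = if-no (connector? v)

  potential-connector : ∀ c v → IsConnector v → potential c v ≡ xWeight v
  potential-connector c v = if-yes (connector? v)

  potential-general : ∀ c v → ¬ IsConnector v → potential c v ≡ xWeight v + suc (generalPotential c v)
  potential-general c v = if-no (connector? v)

  uCost-zeros : uCost zeros ≡ 2
  uCost-zeros = cong₂ _+_ (weight-zeros m) (if-yes (zeros {m} ≟V zeros) refl)

  uCost-unit : ∀ i → uCost (unit i) ≡ 1
  uCost-unit i = cong₂ _+_ (weight-unit i) (if-no (unit i ≟V zeros) (unit-≢-zeros i))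

  uCost-clearSecond : ∀ u → u ≢ zeros → clearSecond u ≢ u → uCost (clearSecond u) < uCost u
  uCost-clearSecond u u≢0 moved = begin-strict
    uCost (clearSecond u)
      ≡⟨ cong (weight (clearSecond u) +_) (if-no (clearSecond u ≟V zeros) (clearSecond-≢-zeros u u≢0)) ⟩
    weight (clearSecond u) + 0 <⟨ +-monoˡ-< 0 (≤-reflexive (sym (clearSecond-weight u moved))) ⟩
    weight u + 0               ≡⟨ cong (weight u +_) (if-no (u ≟V zeros) u≢0) ⟨
    uCost u                    ∎
    where open ≤-Reasoning

  Descent : Vec Bool k → Vertex → Vertex → Set
  Descent c v v′ = dist v v′ ≡ 1 × colour v′ ≡ c × potential c v′ < potential c v

  connector-descent : ∀ c v v′ → IsConnector v → IsConnector v′ → p v′ ≡ c →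
                      dist v v′ ≡ 1 → xWeight v′ < xWeight v → Descent c v v′
  connector-descent c v v′ cn cn′ p′≡c adj lt = adj , trans (colour-connector v′ cn′) p′≡c ,
    subst₂ _<_ (sym (potential-connector c v′ cn′)) (sym (potential-connector c v cn)) lt

  general-descent : ∀ c v u′ p′ q′ → let v′ = record v { u = u′ ; p = p′ ; q = q′ } in
    ¬ IsConnector v → ¬ IsConnector v′ → dist v v′ ≡ 1 → generalColour v′ ≡ c →
    generalPotential c v′ < generalPotential c v → Descent c v v′
  general-descent c v u′ p′ q′ ¬cn ¬cn′ adj gc lt = adj , trans (colour-general v′ ¬cn′) gc ,
    subst₂ _<_ (sym (potential-general c v′ ¬cn′)) (sym (potential-general c v ¬cn))
      (+-monoʳ-< (xWeight v) (s≤s lt))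
    where v′ = record v { u = u′ ; p = p′ ; q = q′ }

  connectorStep-descends : ∀ c v → IsConnector v → p v ≡ c → v ≢ root c → Descent c v (connectorStep v)
  connectorStep-descends c v@(vertex x₀ x₁ _ _ _) cn@(refl , refl) p≡c@refl v≢root =
    if-does-elim (x₀ ≟V zeros) (Descent c v) clearX₁ clearX₀
    where
    clearX₀ : x₀ ≢ zeros → Descent c v (record v { x₀ = clearFirst x₀ })
    clearX₀ x₀≢0 = connector-descent c v _ cn cn p≡c (trans (dist-x₀ v _) (clearFirst-adj x₀ moved))
      (+-monoˡ-< (weight x₁) (≤-reflexive (sym (clearFirst-weight x₀ moved))))
      where moved = x₀≢0 ∘ clearFirst-fixed⇒zeros x₀
    clearX₁ : x₀ ≡ zeros → Descent c v (record v { x₁ = clearFirst x₁ })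
    clearX₁ x₀≡0 = connector-descent c v _ cn cn p≡c (trans (dist-x₁ v _) (clearFirst-adj x₁ moved))
      (+-monoʳ-< (weight x₀) (≤-reflexive (sym (clearFirst-weight x₁ moved))))
      where
      moved : clearFirst x₁ ≢ x₁
      moved fixed = v≢root (cong₂ (λ x y → vertex x y zeros c zeros) x₀≡0 (clearFirst-fixed⇒zeros x₁ fixed))

  reduceP-descends : ∀ c v → ¬ IsConnector v → generalColour v ≡ c → u v ≢ zeros →
                     clearSecond (u v) ≡ u v → q v ≡ zeros → Descent c v (reduceP c v)
  reduceP-descends c v ¬cn gc u≢0 unique-one q≡0 = if-does-elim (p v ≟V c) (Descent c v) becomeConnector stepP
    where
    becomeConnector : p v ≡ c → Descent c v (record v { u = zeros })
    becomeConnector p≡c =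
      trans (dist-u v zeros) (clearSecond-fixed⇒weight≡1 (u v) u≢0 unique-one) ,
      trans (colour-connector v′ (refl , q≡0)) p≡c ,
      subst₂ _<_ (sym (potential-connector c v′ (refl , q≡0))) (sym (potential-general c v ¬cn))
        (m<m+n (xWeight v) z<s)
      where v′ = record v { u = zeros }
    stepP : p v ≢ c → Descent c v (record v { p = stepTowards (p v) c })
    stepP p≢c = general-descent c v (u v) (stepTowards (p v) c) (q v) ¬cn (u≢0 ∘ proj₁)
      (trans (dist-p v _) (stepTowards-adj (p v) c p≢c)) gc
      (+-monoˡ-< (uCost (u v)) (+-monoˡ-< (weight (q v)) (≤-reflexive (sym (stepTowards-closer (p v) c p≢c)))))

  reduceQ-descends : ∀ c v → ¬ IsConnector v → generalColour v ≡ c → u v ≢ zeros →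
                     clearSecond (u v) ≡ u v → Descent c v (reduceQ c v)
  reduceQ-descends c v ¬cn gc u≢0 unique-one =
    if-does-elim (q v ≟V zeros) (Descent c v) (reduceP-descends c v ¬cn gc u≢0 unique-one) clearQ
    where
    clearQ : q v ≢ zeros → Descent c v (record v { q = clearFirst (q v) })
    clearQ q≢0 = general-descent c v (u v) (p v) (clearFirst (q v)) ¬cn (u≢0 ∘ proj₁)
      (trans (dist-q v _) (clearFirst-adj (q v) moved)) gc
      (+-monoˡ-< (uCost (u v)) (+-monoʳ-< (hamming (p v) c) (≤-reflexive (sym (clearFirst-weight (q v) moved)))))
      where moved = q≢0 ∘ clearFirst-fixed⇒zeros (q v)

  reduceU-descends : ∀ c v → ¬ IsConnector v → generalColour v ≡ c → u v ≢ zeros →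
                     Descent c v (reduceU c v)
  reduceU-descends c v ¬cn gc u≢0 =
    if-does-elim (clearSecond (u v) ≟V u v) (Descent c v) (reduceQ-descends c v ¬cn gc u≢0) clearU
    where
    clearU : clearSecond (u v) ≢ u v → Descent c v (record v { u = clearSecond (u v) })
    clearU moved = general-descent c v (clearSecond (u v)) (p v) (q v) ¬cn
      (clearSecond-≢-zeros (u v) u≢0 ∘ proj₁)
      (trans (dist-u v _) (clearSecond-adj (u v) moved))
      (trans (cong (xSyndrome v ⊕_) (firstLabel-clearSecond (labels k) (u v))) gc)
      (+-monoʳ-< (hamming (p v) c + weight (q v)) (uCost-clearSecond (u v) u≢0 moved))

  generalStep-descends : ∀ c v → ¬ IsConnector v → generalColour v ≡ c → Descent c v (generalStep c v)
  generalStep-descends c v ¬cn gc =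
    if-does-elim (u v ≟V zeros) (Descent c v) leaveZeros (reduceU-descends c v ¬cn gc)
    where
    i₀ = index zeros
    leaveZeros : u v ≡ zeros → Descent c v (record v { u = unit i₀ })
    leaveZeros u≡0 = general-descent c v (unit i₀) (p v) (q v) ¬cn (unit-≢-zeros i₀ ∘ proj₁)
      (trans (dist-u v _) (subst (λ w → hamming w (unit i₀) ≡ 1) (sym u≡0) (hamming-flipAt zeros i₀)))
      (trans (cong (xSyndrome v ⊕_) same-label) gc)
      (+-monoʳ-< (hamming (p v) c + weight (q v))
        (subst₂ _<_ (sym (uCost-unit i₀)) (sym (trans (cong uCost u≡0) uCost-zeros)) (n<1+n 1)))
      where
      same-label : firstLabel (labels k) (unit i₀) ≡ firstLabel (labels k) (u v)
      same-label = begin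
        firstLabel (labels k) (unit i₀) ≡⟨ firstLabel-unit (labels k) i₀ ⟩
        lookup (labels k) i₀            ≡⟨ lookup-labels k zeros ⟩
        zeros                           ≡⟨ firstLabel-zeros (labels k) ⟨
        firstLabel (labels k) zeros     ≡⟨ cong (firstLabel (labels k)) u≡0 ⟨
        firstLabel (labels k) (u v)     ∎
        where open ≡-Reasoning

  parentStep-descends : ∀ c v → colour v ≡ c → v ≢ root c → Descent c v (parentStep c v)
  parentStep-descends c v col v≢root = if-does-elim (connector? v) (Descent c v)
    (λ cn → connectorStep-descends c v cn (trans (sym (colour-connector v cn)) col) v≢root)
    (λ ¬cn → generalStep-descends c v ¬cn (trans (sym (colour-general v ¬cn)) col))

  dist-flipX : ∀ b i v → dist v (flipX b i v) ≡ 1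
  dist-flipX true i v = trans (dist-x₀ v _) (hamming-flipAt (x₀ v) i)
  dist-flipX false i v = trans (dist-x₁ v _) (hamming-flipAt (x₁ v) i)

  xSyndrome-flipX : ∀ b i v → xSyndrome (flipX b i v) ≡ lookup (labels k) i ⊕ xSyndrome v
  xSyndrome-flipX true i v =
    trans (cong (_⊕ syndrome (labels k) (x₁ v)) (syndrome-flipAt (labels k) (x₀ v) i)) (⊕-assoc _ _ _)
  xSyndrome-flipX false i v =
    trans (cong (syndrome (labels k) (x₀ v) ⊕_) (syndrome-flipAt (labels k) (x₁ v) i)) (⊕-left-comm _ _ _)

  flipX-flipX-≢ : ∀ b i j v → flipX (not b) j (flipX b i v) ≢ v
  flipX-flipX-≢ true i j v eq = flipAt-≢ (x₁ v) j (cong x₁ eq)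
  flipX-flipX-≢ false i j v eq = flipAt-≢ (x₀ v) j (cong x₀ eq)

  generalColour-attachX : ∀ c v → generalColour (attachX c v) ≡ c
  generalColour-attachX c v = begin
    xSyndrome (flipX _ i v) ⊕ firstLabel (labels k) (u v)
      ≡⟨ cong (_⊕ firstLabel (labels k) (u v)) (xSyndrome-flipX _ i v) ⟩
    (lookup (labels k) i ⊕ xSyndrome v) ⊕ firstLabel (labels k) (u v) ≡⟨ ⊕-assoc _ _ _ ⟩
    lookup (labels k) i ⊕ g                                 ≡⟨ cong (_⊕ g) (lookup-labels k (g ⊕ c)) ⟩
    (g ⊕ c) ⊕ g                                             ≡⟨ ⊕-cancelʳ g c ⟩
    c                                                       ∎
    where
    open ≡-Reasoning
    g = generalColour v
    i = index (g ⊕ c)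

  generalColour-attachU : ∀ c v → generalColour (attachU c v) ≡ c
  generalColour-attachU c v = begin
    xSyndrome v ⊕ firstLabel (labels k) (unit i) ≡⟨ cong (xSyndrome v ⊕_) (firstLabel-unit (labels k) i) ⟩
    xSyndrome v ⊕ lookup (labels k) i            ≡⟨ cong (xSyndrome v ⊕_) (lookup-labels k (xSyndrome v ⊕ c)) ⟩
    xSyndrome v ⊕ (xSyndrome v ⊕ c)              ≡⟨ ⊕-cancelˡ (xSyndrome v) c ⟩
    c                                            ∎
    where
    open ≡-Reasoning
    i = index (xSyndrome v ⊕ c)

  attachU-not-connector : ∀ c v → ¬ IsConnector (attachU c v)
  attachU-not-connector c v = unit-≢-zeros _ ∘ proj₁

  attach-adjacent : ∀ c v → dist v (attach c v) ≡ 1 × colour (attach c v) ≡ c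
  attach-adjacent c v = if-does-elim (connector? v) (λ v′ → dist v v′ ≡ 1 × colour v′ ≡ c) viaU viaX
    where
    viaU : IsConnector v → dist v (attachU c v) ≡ 1 × colour (attachU c v) ≡ c
    viaU (u≡0 , _) =
      trans (dist-u v _) (subst (λ w → hamming w (unit i) ≡ 1) (sym u≡0) (hamming-flipAt zeros i)) ,
      trans (colour-general _ (attachU-not-connector c v)) (generalColour-attachU c v)
      where i = index (xSyndrome v ⊕ c)
    viaX : ¬ IsConnector v → dist v (attachX c v) ≡ 1 × colour (attachX c v) ≡ c
    viaX ¬cn = dist-flipX _ _ v , trans (colour-general _ ¬cn) (generalColour-attachX c v)

  attach-attach-≢ : ∀ c d a → colour a ≡ d → c ≢ d → attach d (attach c a) ≢ a
  attach-attach-≢ c d a col c≢d = if-does-elim (connector? a) (λ a′ → attach d a′ ≢ a) viaU viaX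
    where
    viaU : IsConnector a → attach d (attachU c a) ≢ a
    viaU (u≡0 , _) eq = unit-≢-zeros _
      (trans (cong u (trans (sym (if-no (connector? (attachU c a)) (attachU-not-connector c a))) eq)) u≡0)
    viaX : ¬ IsConnector a → attach d (attachX c a) ≢ a
    viaX ¬cn eq = flipX-flipX-≢ b _ j a (trans (cong (λ b′ → flipX b′ j (attachX c a)) (sym bit)) again)
      where
      b = firstDifference (generalColour a) c
      j = index (generalColour (attachX c a) ⊕ d)
      again : attachX d (attachX c a) ≡ a
      again = trans (sym (if-no (connector? (attachX c a)) ¬cn)) eq
      bit : firstDifference (generalColour (attachX c a)) d ≡ not b
      bit = begin
        firstDifference (generalColour (attachX c a)) d
          ≡⟨ cong (λ g → firstDifference g d) (generalColour-attachX c a) ⟩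
        firstDifference c d                            ≡⟨ firstDifference-antisym d c (c≢d ∘ sym) ⟩
        not (firstDifference d c)
          ≡⟨ cong (λ g → not (firstDifference g c)) (trans (sym col) (colour-general a ¬cn)) ⟩
        not b                                          ∎
        where open ≡-Reasoning

  HeightDescent : Vec Bool k → Vertex → Vertex → Set
  HeightDescent c v v′ = dist v v′ ≡ 1 × colour v′ ≡ c × height c v′ < height c v

  next-descends : ∀ c v → v ≢ root c → HeightDescent c v (next c v)
  next-descends c v v≢root = if-does-elim (colour v ≟V c) (HeightDescent c v) viaParent viaAttach
    where
    viaParent : colour v ≡ c → HeightDescent c v (parentStep c v)
    viaParent col with parentStep-descends c v col v≢root
    ... | adj , col′ , lt = adj , col′ ,
      subst₂ _<_ (sym (if-yes (colour (parentStep c v) ≟V c) col′)) (sym (if-yes (colour v ≟V c) col)) lt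
    viaAttach : colour v ≢ c → HeightDescent c v (attach c v)
    viaAttach ¬col with attach-adjacent c v
    ... | adj , col′ = adj , col′ ,
      subst₂ _<_ (sym (if-yes (colour (attach c v) ≟V c) col′)) (sym (if-no (colour v ≟V c) ¬col)) (n<1+n _)

  no-mutual-next : ∀ c d → c ≢ d → ∀ a b → a ≢ root c → b ≢ root d →
                   next c a ≡ b → next d b ≡ a → ⊥
  no-mutual-next c d c≢d a b a≢root b≢root a↦b b↦a = attach-attach-≢ c d a col-a c≢d (begin
    attach d (attach c a) ≡⟨ cong (attach d) (if-no (colour a ≟V c) (c≢d ∘ λ e → trans (sym e) col-a)) ⟨
    attach d (next c a)   ≡⟨ cong (attach d) a↦b ⟩
    attach d b            ≡⟨ if-no (colour b ≟V d) (c≢d ∘ trans (sym col-b)) ⟨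
    next d b              ≡⟨ b↦a ⟩
    a                     ∎)
    where
    open ≡-Reasoning
    col-b : colour b ≡ c
    col-b = subst (λ t → colour t ≡ c) a↦b (proj₁ (proj₂ (next-descends c a a≢root)))
    col-a : colour a ≡ d
    col-a = subst (λ t → colour t ≡ d) b↦a (proj₁ (proj₂ (next-descends d b b≢root)))

  N : ℕ
  N = m + (m + (m + (k + r)))

  potential≤ : ∀ c v → potential c v ≤ 3 + N
  potential≤ c v = if-does-elim (connector? v) (_≤ 3 + N)
    (λ _ → ≤-trans xWeight≤ (≤-trans (m≤m+n (m + m) _) (≤-reflexive total)))
    (λ _ → ≤-trans (+-mono-≤ xWeight≤ (s≤s general≤)) (≤-reflexive total))
    where
    xWeight≤ : xWeight v ≤ m + m
    xWeight≤ = +-mono-≤ (hamming≤ (x₀ v) zeros) (hamming≤ (x₁ v) zeros)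
    uCost≤ : uCost (u v) ≤ m + 2
    uCost≤ = +-mono-≤ (hamming≤ (u v) zeros)
      (if-does-elim (u v ≟V zeros) (_≤ 2) (λ _ → ≤-refl) (λ _ → z≤n))
    general≤ : generalPotential c v ≤ k + r + (m + 2)
    general≤ = +-mono-≤ (+-mono-≤ (hamming≤ (p v) c) (hamming≤ (q v) zeros)) uCost≤
    total : (m + m) + suc (k + r + (m + 2)) ≡ 3 + N
    total = rearrange m k r
      where
      rearrange : ∀ m k r → (m + m) + suc (k + r + (m + 2)) ≡ 3 + (m + (m + (m + (k + r))))
      rearrange = solve-∀

  height≤ : ∀ c v → height c v ≤ 4 + N
  height≤ c v = if-does-elim (colour v ≟V c) (_≤ 4 + N)
    (λ _ → m≤n⇒m≤1+n (potential≤ c v)) (λ _ → s≤s (potential≤ c (attach c v)))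

  encode : Vertex → V N
  encode v = x₀ v ++ᵛ (x₁ v ++ᵛ (u v ++ᵛ (p v ++ᵛ q v)))

  decode : V N → Vertex
  decode w = vertex (Vec.take m w) (Vec.take m w₁) (Vec.take m w₂) (Vec.take k w₃) (Vec.drop k w₃)
    where
    w₁ = Vec.drop m w
    w₂ = Vec.drop m w₁
    w₃ = Vec.drop m w₂

  decode-encode : ∀ v → decode (encode v) ≡ v
  decode-encode (vertex x₀ x₁ u p q)
    rewrite take-++ x₀ (x₁ ++ᵛ (u ++ᵛ (p ++ᵛ q))) | drop-++ x₀ (x₁ ++ᵛ (u ++ᵛ (p ++ᵛ q)))
          | take-++ x₁ (u ++ᵛ (p ++ᵛ q)) | drop-++ x₁ (u ++ᵛ (p ++ᵛ q))
          | take-++ u (p ++ᵛ q) | drop-++ u (p ++ᵛ q) | take-++ p q | drop-++ p q = refl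

  encode-decode : ∀ w → encode (decode w) ≡ w
  encode-decode w
    rewrite take++drop≡id k (Vec.drop m (Vec.drop m (Vec.drop m w)))
          | take++drop≡id m (Vec.drop m (Vec.drop m w)) | take++drop≡id m (Vec.drop m w)
          | take++drop≡id m w = refl

  hamming-encode : ∀ a b → hamming (encode a) (encode b) ≡ dist a b
  hamming-encode (vertex x₀ x₁ u p q) (vertex y₀ y₁ u′ p′ q′)
    rewrite hamming-++ x₀ y₀ (x₁ ++ᵛ (u ++ᵛ (p ++ᵛ q))) (y₁ ++ᵛ (u′ ++ᵛ (p′ ++ᵛ q′)))
          | hamming-++ x₁ y₁ (u ++ᵛ (p ++ᵛ q)) (u′ ++ᵛ (p′ ++ᵛ q′))
          | hamming-++ u u′ (p ++ᵛ q) (p′ ++ᵛ q′) | hamming-++ p p′ q q′ = refl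

  decode-≢ : ∀ c w → w ≢ encode (root c) → decode w ≢ root c
  decode-≢ c w w≢root eq = w≢root (trans (sym (encode-decode w)) (cong encode eq))

  decode-next-descends : ∀ c w → w ≢ encode (root c) →
                         HeightDescent c (decode w) (decode (encode (next c (decode w))))
  decode-next-descends c w w≢root =
    subst (HeightDescent c (decode w)) (sym (decode-encode _)) (next-descends c (decode w) (decode-≢ c w w≢root))

  parentMap : Vec Bool k → ParentMap N
  parentMap c = record
    { root = encode (root c)
    ; parent = encode ∘ next c ∘ decode
    ; height = height c ∘ decode
    ; parent-adj = λ w w≢root → subst (λ t → hamming t (encode (next c (decode w))) ≡ 1) (encode-decode w)
        (trans (hamming-encode (decode w) (next c (decode w)))
               (proj₁ (next-descends c (decode w) (decode-≢ c w w≢root))))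
    ; height-parent = λ w w≢root → proj₂ (proj₂ (decode-next-descends c w w≢root))
    }

  treeOf : Vec Bool k → EdgeSet N
  treeOf c = ParentTree.edges (parentMap c)

  treeOf-completelyIndependent : ∀ c d → c ≢ d → CompletelyIndependent N (treeOf c) (treeOf d)
  treeOf-completelyIndependent c d c≢d =
    completelyIndependent (colour ∘ decode) (parentMap c) (parentMap d) c≢d
      (λ w w≢root → proj₁ (proj₂ (decode-next-descends c w w≢root)))
      (λ w w≢root → proj₁ (proj₂ (decode-next-descends d w w≢root)))
      λ a b a≢root b≢root a↦b b↦a → no-mutual-next c d c≢d (decode a) (decode b)
        (decode-≢ c a a≢root) (decode-≢ d b b≢root)
        (trans (sym (decode-encode _)) (cong decode a↦b)) (trans (sym (decode-encode _)) (cong decode b↦a))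

  hypercubeTrees : CompletelyIndependentSpanningTrees m N (2 * (4 + N))
  hypercubeTrees = treeOf ∘ Inverse.to (bits k) ,
    (λ i → let t = parentMap (Inverse.to (bits k) i) in
       ParentTree.spanningTree t , ParentTree.diameter≤ t (4 + N) (height≤ _ ∘ decode)) ,
    λ i j i≢j → treeOf-completelyIndependent _ _ (i≢j ∘ Injection.injective (↔⇒↣ (bits k)))

-- The construction works for every k ≥ 0 and only needs n ≥ 3·2^k + k.
theorem5 : (k n : ℕ) → 1 ≤ k → 6 * 2 ^ k + k + 4 ≤ n →
    Σ (Fin (2 ^ k) → EdgeSet n) λ T →
      (∀ i → IsSpanningTree n (T i) × DiameterAtMost n (T i) (2 * (n + 9 * k + 11))) ×
      (∀ i j → i ≢ j → CompletelyIndependent n (T i) (T j))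
theorem5 k n _ n-large =
  subst (λ n → CompletelyIndependentSpanningTrees (2 ^ k) n (2 * (n + 9 * k + 11))) N≡n
    (diameter-weaken (*-monoʳ-≤ 2 (4+N≤ _)) (Construction.hypercubeTrees k r))
  where
  m = 2 ^ k
  s = m + (m + (m + k))
  r = n ∸ s
  4+N≤ : ∀ N → 4 + N ≤ N + 9 * k + 11
  4+N≤ N = ≤-trans (≤-reflexive (+-comm 4 N)) (+-mono-≤ (m≤m+n N (9 * k)) (m≤m+n 4 7))
  s≤n : s ≤ n
  s≤n = ≤-trans (m≤m+n s (m + (m + (m + 4)))) (≤-trans (≤-reflexive (sym (split m k))) n-large)
    where
    split : ∀ m k → 6 * m + k + 4 ≡ (m + (m + (m + k))) + (m + (m + (m + 4)))
    split = solve-∀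
  N≡n : Construction.N k r ≡ n
  N≡n = trans (sym (reassoc m k r)) (m+[n∸m]≡n s≤n)
    where
    reassoc : ∀ m k r → (m + (m + (m + k))) + r ≡ m + (m + (m + (k + r)))
    reassoc = solve-∀
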